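{- For any nonnegative integers $n,m$, $$\sum_{k=0}^n\binom{n}{k}^{ -m}=(n+1)^m\sum_{k=0}^n\left[\sum_{i=0}^k\frac{(-1)^i}{n-k+1+i}\binom{k}{i}\right]^m .$$ -}

module Defs where

open import Data.Nat using (ℕ; zero; suc)
open import Data.Integer using (ℤ; +_; -[1+_])
open import Data.Rational using (ℚ; 0ℚ; 1ℚ; _+_; _*_; _/_)
open import Data.List using (List; foldr; map; upTo)

_^ℚ_ : ℚ → ℕ → ℚ
p ^ℚ zero = 1ℚ
p ^ℚ suc m = p * (p ^ℚ m)

sumTo : ℕ → (ℕ → ℚ) → ℚ
sumTo n f = foldr _+_ 0ℚ (map f (upTo (suc n)))

-- reciprocal of a natural number as a rational; convention 1/0 := 0
-- (only ever applied to nonzero arguments in the statement)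
inv : ℕ → ℚ
inv zero = 0ℚ
inv (suc d) = + 1 / suc d

sgn : ℕ → ℚ
sgn zero = 1ℚ
sgn (suc i) = -[1+ 0 ] / 1 * sgn i

ℕ→ℚ : ℕ → ℚ
ℕ→ℚ k = + k / 1

-- The inner sum is the Beta integral ∫₀¹ x^(n−k) (1−x)^k dx expanded binomially, so it equals
-- (n−k)! k! / (n+1)! = 1 / ((n+1) C(n,k)); raising to the m-th power and summing over k gives the
-- theorem. Without integrals, the closed form a! k! / (a+k+1)! of Σᵢ (−1)ⁱ C(k,i) / (a+1+i) is
-- proved by induction on k: Pascal's rule splits the sum for (a, k) into those for (a, k+1) and
-- (a+1, k), and the closed form satisfies the same recurrence.
module Submission where

open import Defs
open import Algebra.Bundles using (CommutativeMonoid; CommutativeRing)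
open import Data.Empty using (⊥-elim)
open import Data.Fin using (toℕ)
open import Data.Fin.Properties using (toℕ≤pred[n])
import Data.Integer as ℤ
import Data.Integer.Properties as ℤP
open import Data.Integer.Solver using (module +-*-Solver)
open import Data.List as List using (applyUpTo)
open import Data.Nat as ℕ using (ℕ; zero; suc; _∸_; _!; NonZero) renaming (_+_ to _+ℕ_)
open import Data.Nat.Combinatorics
  using (_C_; nCk+nC[k+1]≡[n+1]C[k+1]; nCk≡n!/k![n-k]!; k![n∸k]!∣n!)
open import Data.Nat.DivMod using (_/_; m/n*n≡m)
import Data.Nat.Properties as ℕP
open import Data.Nat.Properties using (_!≢0; _!*_!≢0)
open import Data.Rational using (ℚ; _*_; _+_; _-_; -_; 0ℚ; 1ℚ; fromℚᵘ)
open import Data.Rational.Properties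
open import Data.Rational.Solver using (module +-*-Solver)
open import Data.Rational.Unnormalised as ℚᵘ using (mkℚᵘ; *≡*)
import Data.Rational.Unnormalised.Properties as ℚᵘP
open import Data.Vec.Functional using (Vector; head; tail)
open import Function using (_∘_; id)
open import Relation.Binary.PropositionalEquality

open ≡-Reasoning

fromℚᵘ-homo-+ : ∀ p q → fromℚᵘ (p ℚᵘ.+ q) ≡ fromℚᵘ p + fromℚᵘ q
fromℚᵘ-homo-+ p q = toℚᵘ-injective (ℚᵘP.≃-trans (toℚᵘ-fromℚᵘ (p ℚᵘ.+ q)) (ℚᵘP.≃-sym
  (ℚᵘP.≃-trans (toℚᵘ-homo-+ (fromℚᵘ p) (fromℚᵘ q)) (ℚᵘP.+-cong (toℚᵘ-fromℚᵘ p) (toℚᵘ-fromℚᵘ q)))))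

fromℚᵘ-homo-* : ∀ p q → fromℚᵘ (p ℚᵘ.* q) ≡ fromℚᵘ p * fromℚᵘ q
fromℚᵘ-homo-* p q = toℚᵘ-injective (ℚᵘP.≃-trans (toℚᵘ-fromℚᵘ (p ℚᵘ.* q)) (ℚᵘP.≃-sym
  (ℚᵘP.≃-trans (toℚᵘ-homo-* (fromℚᵘ p) (fromℚᵘ q)) (ℚᵘP.*-cong (toℚᵘ-fromℚᵘ p) (toℚᵘ-fromℚᵘ q)))))

-- ℕ→ℚ x and inv (suc d) are by definition fromℚᵘ (x / 1) and fromℚᵘ (1 / suc d), so identities
-- between them reduce to cross-multiplied identities in ℤ.
ℕ→ℚ-homo-+ : ∀ x y → ℕ→ℚ (x +ℕ y) ≡ ℕ→ℚ x + ℕ→ℚ y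
ℕ→ℚ-homo-+ x y = trans
  (fromℚᵘ-cong {mkℚᵘ (ℤ.+ (x +ℕ y)) 0} {mkℚᵘ (ℤ.+ x) 0 ℚᵘ.+ mkℚᵘ (ℤ.+ y) 0} (*≡*
    (solve 2 (λ a b → (a :+ b) :* con (ℤ.+ 1) := (a :* con (ℤ.+ 1) :+ b :* con (ℤ.+ 1)) :* con (ℤ.+ 1))
      refl (ℤ.+ x) (ℤ.+ y))))
  (fromℚᵘ-homo-+ (mkℚᵘ (ℤ.+ x) 0) (mkℚᵘ (ℤ.+ y) 0))
  where open Data.Integer.Solver.+-*-Solver

ℕ→ℚ-homo-* : ∀ x y → ℕ→ℚ (x ℕ.* y) ≡ ℕ→ℚ x * ℕ→ℚ y
ℕ→ℚ-homo-* x y = trans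
  (fromℚᵘ-cong {mkℚᵘ (ℤ.+ (x ℕ.* y)) 0} {mkℚᵘ (ℤ.+ x) 0 ℚᵘ.* mkℚᵘ (ℤ.+ y) 0} (*≡*
    (cong (ℤ._* ℤ.+ 1) (ℤP.pos-* x y))))
  (fromℚᵘ-homo-* (mkℚᵘ (ℤ.+ x) 0) (mkℚᵘ (ℤ.+ y) 0))

ℕ→ℚ-*-inv : ∀ x .{{_ : NonZero x}} → ℕ→ℚ x * inv x ≡ 1ℚ
ℕ→ℚ-*-inv x@(suc d) = sym (trans
  (fromℚᵘ-cong {mkℚᵘ (ℤ.+ 1) 0} {mkℚᵘ (ℤ.+ x) 0 ℚᵘ.* mkℚᵘ (ℤ.+ 1) d} (*≡*
    (solve 1 (λ a → con (ℤ.+ 1) :* (con (ℤ.+ 1) :* a) := (a :* con (ℤ.+ 1)) :* con (ℤ.+ 1))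
      refl (ℤ.+ x))))
  (fromℚᵘ-homo-* (mkℚᵘ (ℤ.+ x) 0) (mkℚᵘ (ℤ.+ 1) d)))
  where open Data.Integer.Solver.+-*-Solver

inv[x]*[x*p]≡p : ∀ x .{{_ : NonZero x}} p → inv x * (ℕ→ℚ x * p) ≡ p
inv[x]*[x*p]≡p x p = begin
  inv x * (ℕ→ℚ x * p)   ≡⟨ *-assoc (inv x) (ℕ→ℚ x) p ⟨
  (inv x * ℕ→ℚ x) * p   ≡⟨ cong (_* p) (trans (*-comm (inv x) (ℕ→ℚ x)) (ℕ→ℚ-*-inv x)) ⟩
  1ℚ * p                ≡⟨ *-identityˡ p ⟩
  p                     ∎

ℕ→ℚ-*-cancelˡ : ∀ x .{{_ : NonZero x}} {p q} → ℕ→ℚ x * p ≡ ℕ→ℚ x * q → p ≡ q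
ℕ→ℚ-*-cancelˡ x {p} {q} eq = begin
  p                     ≡⟨ inv[x]*[x*p]≡p x p ⟨
  inv x * (ℕ→ℚ x * p)   ≡⟨ cong (inv x *_) eq ⟩
  inv x * (ℕ→ℚ x * q)   ≡⟨ inv[x]*[x*p]≡p x q ⟩
  q                     ∎

inv-unique : ∀ x p → ℕ→ℚ x * p ≡ 1ℚ → p ≡ inv x
inv-unique zero      p eq = ⊥-elim (1≢0 (trans (sym eq) (*-zeroˡ p)))
inv-unique x@(suc _) p eq = begin
  p                     ≡⟨ inv[x]*[x*p]≡p x p ⟨
  inv x * (ℕ→ℚ x * p)   ≡⟨ cong (inv x *_) eq ⟩
  inv x * 1ℚ            ≡⟨ *-identityʳ (inv x) ⟩
  inv x                 ∎

sgn-suc : ∀ i → sgn (suc i) ≡ - sgn i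
sgn-suc i = trans (sym (neg-distribˡ-* 1ℚ (sgn i))) (cong -_ (*-identityˡ (sgn i)))

^ℚ-distrib-* : ∀ p q m → (p * q) ^ℚ m ≡ p ^ℚ m * q ^ℚ m
^ℚ-distrib-* p q zero    = refl
^ℚ-distrib-* p q (suc m) = begin
  (p * q) * (p * q) ^ℚ m        ≡⟨ cong ((p * q) *_) (^ℚ-distrib-* p q m) ⟩
  (p * q) * (p ^ℚ m * q ^ℚ m)   ≡⟨ solve 4 (λ p q a b → (p :* q) :* (a :* b) := (p :* a) :* (q :* b))
                                     refl p q (p ^ℚ m) (q ^ℚ m) ⟩
  (p * p ^ℚ m) * (q * q ^ℚ m)   ∎
  where open Data.Rational.Solver.+-*-Solver

module _ {c ℓ} (M : CommutativeMonoid c ℓ) where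
  open CommutativeMonoid M
    using (Carrier; _≈_; _∙_; ε; identityˡ; ∙-congˡ; commutativeSemigroup)
    renaming (sym to ≈-sym; trans to ≈-trans)
  open import Algebra.Properties.CommutativeMonoid.Sum M using (sum)
  open import Algebra.Properties.CommutativeSemigroup commutativeSemigroup using (interchange)

  sum-distrib-∙ : ∀ {n} (f g : Vector Carrier n) → sum (λ i → f i ∙ g i) ≈ sum f ∙ sum g
  sum-distrib-∙ {zero}  f g = ≈-sym (identityˡ ε)
  sum-distrib-∙ {suc n} f g =
    ≈-trans (∙-congˡ (sum-distrib-∙ (tail f) (tail g))) (interchange (head f) (head g) _ _)

open import Algebra.Properties.Semiring.Sum (CommutativeRing.semiring +-*-commutativeRing)
  using (sum; sum-syntax; sum⁺-syntax; sum-cong-≗; sum-replicate-zero; *-distribˡ-sum)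

foldr-applyUpTo-∑ : ∀ N (g : ℕ → ℕ) (f : ℕ → ℚ) →
  List.foldr _+_ 0ℚ (List.map f (applyUpTo g N)) ≡ ∑[ i < N ] f (g (toℕ i))
foldr-applyUpTo-∑ zero    g f = refl
foldr-applyUpTo-∑ (suc N) g f = cong (f (g 0) +_) (foldr-applyUpTo-∑ N (g ∘ suc) f)

sumTo≡∑ : ∀ n f → sumTo n f ≡ ∑[ i ≤ n ] f (toℕ i)
sumTo≡∑ n f = foldr-applyUpTo-∑ (suc n) id f

β-summand : ℕ → ℕ → ℕ → ℚ
β-summand a k i = sgn i * inv (a +ℕ 1 +ℕ i) * ℕ→ℚ (k C i)

β-sum : ℕ → ℕ → ℕ → ℚ
β-sum N a k = ∑[ i < N ] β-summand a k (toℕ i)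

β-summand-zero : ∀ a k → β-summand a k 0 ≡ inv (suc a)
β-summand-zero a k = begin
  1ℚ * inv (a +ℕ 1 +ℕ 0) * 1ℚ   ≡⟨ cong (λ d → 1ℚ * inv d * 1ℚ) a+1+0≡1+a ⟩
  1ℚ * inv (suc a) * 1ℚ          ≡⟨ trans (*-identityʳ _) (*-identityˡ _) ⟩
  inv (suc a)                    ∎
  where
  a+1+0≡1+a : a +ℕ 1 +ℕ 0 ≡ suc a
  a+1+0≡1+a = trans (ℕP.+-identityʳ (a +ℕ 1)) (ℕP.+-comm a 1)

β-summand-pascal : ∀ a k i →
  β-summand a k (suc i) ≡ β-summand a (suc k) (suc i) + β-summand (suc a) k i
β-summand-pascal a k i = begin
  sgn (suc i) * I * Q             ≡⟨ cong (λ s → s * I * Q) (sgn-suc i) ⟩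
  - s * I * Q                     ≡⟨ solve 4 (λ s I P Q → :- s :* I :* Q := :- s :* I :* (P :+ Q) :+ s :* I :* P)
                                       refl s I P Q ⟩
  - s * I * (P + Q) + s * I * P   ≡⟨ cong₂ (λ u d → u + s * inv d * P) pascal (ℕP.+-suc (a +ℕ 1) i) ⟩
  β-summand a (suc k) (suc i) + β-summand (suc a) k i ∎
  where
  open Data.Rational.Solver.+-*-Solver
  s I P Q : ℚ
  s = sgn i
  I = inv (a +ℕ 1 +ℕ suc i)
  P = ℕ→ℚ (k C i)
  Q = ℕ→ℚ (k C suc i)
  pascal : - s * I * (P + Q) ≡ sgn (suc i) * I * ℕ→ℚ (suc k C suc i)
  pascal = cong₂ (λ t u → t * I * u) (sym (sgn-suc i))
    (trans (sym (ℕ→ℚ-homo-+ (k C i) (k C suc i))) (cong ℕ→ℚ (nCk+nC[k+1]≡[n+1]C[k+1] k i)))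

β-sum-pascal : ∀ N a k → β-sum (suc N) a k ≡ β-sum (suc N) a (suc k) + β-sum N (suc a) k
β-sum-pascal N a k = begin
  β-summand a k 0 + ∑[ i < N ] β-summand a k (suc (toℕ i))
    ≡⟨ cong₂ _+_ (trans (β-summand-zero a k) (sym (β-summand-zero a (suc k))))
                 (sum-cong-≗ {N} (β-summand-pascal a k ∘ toℕ)) ⟩
  β-summand a (suc k) 0 + ∑[ i < N ] (f i + g i)
    ≡⟨ cong (β-summand a (suc k) 0 +_) (sum-distrib-∙ +-0-commutativeMonoid {N} f g) ⟩
  β-summand a (suc k) 0 + (∑[ i < N ] f i + β-sum N (suc a) k)
    ≡⟨ +-assoc (β-summand a (suc k) 0) (∑[ i < N ] f i) (β-sum N (suc a) k) ⟨
  β-sum (suc N) a (suc k) + β-sum N (suc a) k ∎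
  where
  f g : Vector ℚ N
  f i = β-summand a (suc k) (suc (toℕ i))
  g i = β-summand (suc a) k (toℕ i)

-- The recurrence B(a, k+1) = B(a, k) − B(a+1, k) of B(a, k) = a! k! / (a+k+1)!.
β-closed-step : ∀ a k {X Y Z} → X ≡ Y + Z →
  ℕ→ℚ ((a +ℕ k +ℕ 1) !) * X ≡ ℕ→ℚ (a ! ℕ.* k !) →
  ℕ→ℚ ((suc a +ℕ k +ℕ 1) !) * Z ≡ ℕ→ℚ (suc a ! ℕ.* k !) →
  ℕ→ℚ ((a +ℕ suc k +ℕ 1) !) * Y ≡ ℕ→ℚ (a ! ℕ.* suc k !)
β-closed-step a k {X} {Y} {Z} X≡Y+Z FX≡W F′Z≡pW = begin
  ℕ→ℚ ((a +ℕ suc k +ℕ 1) !) * Y   ≡⟨ cong (λ d → ℕ→ℚ (d !) * Y) (cong (_+ℕ 1) (ℕP.+-suc a k)) ⟩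
  F′ * Y                          ≡⟨ solve 3 (λ F′ Y Z → F′ :* Y := F′ :* (Y :+ Z) :- F′ :* Z) refl F′ Y Z ⟩
  F′ * (Y + Z) - F′ * Z           ≡⟨ cong₂ (λ V U → F′ * V - U) (sym X≡Y+Z) (trans F′Z≡pW [1+a]!k!≡pW) ⟩
  F′ * X - p * W                  ≡⟨ cong (λ G → G * X - p * W) F′≡[p+q]F ⟩
  (p + q) * F * X - p * W         ≡⟨ cong (_- p * W) (trans (*-assoc (p + q) F X) (cong ((p + q) *_) FX≡W)) ⟩
  (p + q) * W - p * W             ≡⟨ solve 3 (λ p q W → (p :+ q) :* W :- p :* W := q :* W) refl p q W ⟩
  q * W                           ≡⟨ a![1+k]!≡qW ⟨
  ℕ→ℚ (a ! ℕ.* suc k !)           ∎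
  where
  open Data.Rational.Solver.+-*-Solver
  open import Algebra.Properties.CommutativeSemigroup ℕP.*-commutativeSemigroup using (x∙yz≈y∙xz)
  F F′ p q W : ℚ
  F = ℕ→ℚ ((a +ℕ k +ℕ 1) !)
  F′ = ℕ→ℚ (suc (a +ℕ k +ℕ 1) !)
  p = ℕ→ℚ (suc a)
  q = ℕ→ℚ (suc k)
  W = ℕ→ℚ (a ! ℕ.* k !)
  1+[a+k+1]≡[1+a]+[1+k] : suc (a +ℕ k +ℕ 1) ≡ suc a +ℕ suc k
  1+[a+k+1]≡[1+a]+[1+k] = cong suc (trans (ℕP.+-comm (a +ℕ k) 1) (sym (ℕP.+-suc a k)))
  F′≡[p+q]F : F′ ≡ (p + q) * F
  F′≡[p+q]F = trans (ℕ→ℚ-homo-* (suc (a +ℕ k +ℕ 1)) ((a +ℕ k +ℕ 1) !))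
    (cong (_* F) (trans (cong ℕ→ℚ 1+[a+k+1]≡[1+a]+[1+k]) (ℕ→ℚ-homo-+ (suc a) (suc k))))
  [1+a]!k!≡pW : ℕ→ℚ (suc a ! ℕ.* k !) ≡ p * W
  [1+a]!k!≡pW = trans (cong ℕ→ℚ (ℕP.*-assoc (suc a) (a !) (k !))) (ℕ→ℚ-homo-* (suc a) (a ! ℕ.* k !))
  a![1+k]!≡qW : ℕ→ℚ (a ! ℕ.* suc k !) ≡ q * W
  a![1+k]!≡qW = trans (cong ℕ→ℚ (x∙yz≈y∙xz (a !) (suc k) (k !))) (ℕ→ℚ-homo-* (suc k) (a ! ℕ.* k !))

β-sum-zero : ∀ N a → β-sum (suc N) a 0 ≡ inv (suc a)
β-sum-zero N a = begin
  β-summand a 0 0 + ∑[ i < N ] β-summand a 0 (suc (toℕ i))   ≡⟨ cong₂ _+_ (β-summand-zero a 0) tail≡0 ⟩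
  inv (suc a) + 0ℚ                                          ≡⟨ +-identityʳ (inv (suc a)) ⟩
  inv (suc a)                                               ∎
  where
  -- 0 C suc i computes to 0
  tail≡0 : ∑[ i < N ] β-summand a 0 (suc (toℕ i)) ≡ 0ℚ
  tail≡0 = trans (sum-cong-≗ {N} (λ i → *-zeroʳ (sgn (suc (toℕ i)) * inv (a +ℕ 1 +ℕ suc (toℕ i)))))
                 (sum-replicate-zero N)

-- The summands with i > k vanish, so any number N > k of terms gives the full sum.
β-sum-closed : ∀ N a k → k ℕ.< N → ℕ→ℚ ((a +ℕ k +ℕ 1) !) * β-sum N a k ≡ ℕ→ℚ (a ! ℕ.* k !)
β-sum-closed (suc N) a zero _ = begin
  ℕ→ℚ ((a +ℕ 0 +ℕ 1) !) * β-sum (suc N) a 0   ≡⟨ cong₂ (λ d β → ℕ→ℚ (d !) * β) a+0+1≡1+a (β-sum-zero N a) ⟩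
  ℕ→ℚ (suc a ℕ.* a !) * inv (suc a)           ≡⟨ *-comm (ℕ→ℚ (suc a ℕ.* a !)) (inv (suc a)) ⟩
  inv (suc a) * ℕ→ℚ (suc a ℕ.* a !)           ≡⟨ cong (inv (suc a) *_) (ℕ→ℚ-homo-* (suc a) (a !)) ⟩
  inv (suc a) * (ℕ→ℚ (suc a) * ℕ→ℚ (a !))     ≡⟨ inv[x]*[x*p]≡p (suc a) (ℕ→ℚ (a !)) ⟩
  ℕ→ℚ (a !)                                   ≡⟨ cong ℕ→ℚ (ℕP.*-identityʳ (a !)) ⟨
  ℕ→ℚ (a ! ℕ.* 1)                             ∎
  where
  a+0+1≡1+a : a +ℕ 0 +ℕ 1 ≡ suc a
  a+0+1≡1+a = trans (cong (_+ℕ 1) (ℕP.+-identityʳ a)) (ℕP.+-comm a 1)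
β-sum-closed (suc N) a (suc k) (ℕ.s<s k<N) =
  β-closed-step a k (β-sum-pascal N a k)
    (β-sum-closed (suc N) a k (ℕP.m<n⇒m<1+n k<N))
    (β-sum-closed N (suc a) k k<N)

nCk*[n∸k]!k!≡n! : ∀ {n k} → k ℕ.≤ n → (n C k) ℕ.* ((n ∸ k) ! ℕ.* k !) ≡ n !
nCk*[n∸k]!k!≡n! {n} {k} k≤n = begin
  (n C k) ℕ.* ((n ∸ k) ! ℕ.* k !)             ≡⟨ cong ((n C k) ℕ.*_) (ℕP.*-comm ((n ∸ k) !) (k !)) ⟩
  (n C k) ℕ.* (k ! ℕ.* (n ∸ k) !)             ≡⟨ cong (ℕ._* (k ! ℕ.* (n ∸ k) !)) (nCk≡n!/k![n-k]! k≤n) ⟩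
  n ! / (k ! ℕ.* (n ∸ k) !) ℕ.* (k ! ℕ.* (n ∸ k) !)   ≡⟨ m/n*n≡m (k![n∸k]!∣n! k≤n) ⟩
  n !                                         ∎
  where instance _ = k !* (n ∸ k) !≢0

inv-binomial : ∀ {n k} → k ℕ.≤ n → inv (n C k) ≡ ℕ→ℚ (suc n) * β-sum (suc k) (n ∸ k) k
inv-binomial {n} {k} k≤n = sym (inv-unique (n C k) _ (ℕ→ℚ-*-cancelˡ (n !) (begin
  ℕ→ℚ (n !) * (c * (ℕ→ℚ (suc n) * β))     ≡⟨ solve 4 (λ F c N β → F :* (c :* (N :* β)) := c :* ((N :* F) :* β))
                                               refl (ℕ→ℚ (n !)) c (ℕ→ℚ (suc n)) β ⟩
  c * ((ℕ→ℚ (suc n) * ℕ→ℚ (n !)) * β)     ≡⟨ cong (λ F → c * (F * β)) (ℕ→ℚ-homo-* (suc n) (n !)) ⟨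
  c * (ℕ→ℚ (suc n !) * β)                 ≡⟨ cong (λ d → c * (ℕ→ℚ (d !) * β)) [n∸k]+k+1≡1+n ⟨
  c * (ℕ→ℚ ((n ∸ k +ℕ k +ℕ 1) !) * β)     ≡⟨ cong (c *_) (β-sum-closed (suc k) (n ∸ k) k ℕP.≤-refl) ⟩
  c * ℕ→ℚ ((n ∸ k) ! ℕ.* k !)             ≡⟨ ℕ→ℚ-homo-* (n C k) ((n ∸ k) ! ℕ.* k !) ⟨
  ℕ→ℚ ((n C k) ℕ.* ((n ∸ k) ! ℕ.* k !))   ≡⟨ cong ℕ→ℚ (nCk*[n∸k]!k!≡n! k≤n) ⟩
  ℕ→ℚ (n !)                               ≡⟨ *-identityʳ (ℕ→ℚ (n !)) ⟨
  ℕ→ℚ (n !) * 1ℚ                          ∎)))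
  where
  open Data.Rational.Solver.+-*-Solver
  instance _ = n !≢0
  c β : ℚ
  c = ℕ→ℚ (n C k)
  β = β-sum (suc k) (n ∸ k) k
  [n∸k]+k+1≡1+n : n ∸ k +ℕ k +ℕ 1 ≡ suc n
  [n∸k]+k+1≡1+n = trans (cong (_+ℕ 1) (ℕP.m∸n+n≡m k≤n)) (ℕP.+-comm n 1)

proposition1 : (n m : ℕ) →
    sumTo n (λ k → inv (n C k) ^ℚ m)
      ≡ ℕ→ℚ (suc n) ^ℚ m
        * sumTo n (λ k → sumTo k (λ i → sgn i * inv ((n ∸ k) +ℕ 1 +ℕ i) * ℕ→ℚ (k C i)) ^ℚ m)
proposition1 n m = begin
  sumTo n (λ k → inv (n C k) ^ℚ m)       ≡⟨ sumTo≡∑ n (λ k → inv (n C k) ^ℚ m) ⟩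
  ∑[ k ≤ n ] inv (n C toℕ k) ^ℚ m        ≡⟨ sum-cong-≗ {suc n} (λ k → summand (toℕ≤pred[n] k)) ⟩
  ∑[ k ≤ n ] (c ^ℚ m * G (toℕ k) ^ℚ m)   ≡⟨ *-distribˡ-sum {suc n} (c ^ℚ m) (λ k → G (toℕ k) ^ℚ m) ⟨
  c ^ℚ m * ∑[ k ≤ n ] G (toℕ k) ^ℚ m     ≡⟨ cong (c ^ℚ m *_) (sumTo≡∑ n (λ k → G k ^ℚ m)) ⟨
  c ^ℚ m * sumTo n (λ k → G k ^ℚ m)      ∎
  where
  c : ℚ
  c = ℕ→ℚ (suc n)
  G : ℕ → ℚ
  G k = sumTo k (β-summand (n ∸ k) k)
  summand : ∀ {k} → k ℕ.≤ n → inv (n C k) ^ℚ m ≡ c ^ℚ m * G k ^ℚ m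
  summand {k} k≤n = begin
    inv (n C k) ^ℚ m                     ≡⟨ cong (_^ℚ m) (inv-binomial k≤n) ⟩
    (c * β-sum (suc k) (n ∸ k) k) ^ℚ m   ≡⟨ cong (λ β → (c * β) ^ℚ m) (sumTo≡∑ k (β-summand (n ∸ k) k)) ⟨
    (c * G k) ^ℚ m                       ≡⟨ ^ℚ-distrib-* c (G k) m ⟩
    c ^ℚ m * G k ^ℚ m                    ∎
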